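{- Let $G=(V,E)$ be a control-flow graph with entry $s$ and terminal $t$ as in the context, and let $H=(V,F\cup D)$ be the union of its forward and backward inference graphs. Then every simple directed cycle in $H$ has at most two nodes.
   Context: $G=(V,E)$ is a finite directed graph with distinct nodes $s,t$ such that $s$ has in-degree $0$, $t$ has out-degree $0$, every node is reachable from $s$ and every node can reach $t$ by directed paths. $N^{in}(u),N^{out}(u)$ denote in- and out-neighbour sets. $A(u)$ is the set of nodes reachable from $s$ by a directed path avoiding $u$; $B(u)$ the set of nodes that can reach $t$ by a directed path avoiding $u$. A node $u$ is forward inferable if $N^{out}(u)\setminus A(u)\neq\emptyset$ and $N^{out}(u)\cap A(u)\cap B(u)=\emptyset$; the forward inference graph is $(V,F)$ with $(u,v)\in F$ iff $u$ is forward inferable and $v\in N^{out}(u)\setminus A(u)$. A node $u$ is backward inferable if $N^{in}(u)\setminus B(u)\neq\emptyset$ and $N^{in}(u)\cap A(u)\cap B(u)=\emptyset$; the backward inference graph is $(V,D)$ with $(u,v)\in D$ iff $u$ is backward inferable and $v\in N^{in}(u)\setminus B(u)$. -}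

module Defs where

open import Data.Nat using (ℕ; suc)
open import Data.Nat.DivMod using (_mod_)
open import Data.Fin using (Fin; toℕ)
open import Data.Product using (Σ; _×_; ∃)
open import Data.Sum using (_⊎_)
open import Data.Empty using (⊥)
open import Relation.Nullary using (¬_)
open import Relation.Binary.PropositionalEquality using (_≡_; _≢_)
open import Relation.Binary.Construct.Closure.ReflexiveTransitive using (Star)

Graph : ℕ → Set₁
Graph n = Fin n → Fin n → Set

module _ {n : ℕ} (E : Graph n) where

  data ReachAvoid (u : Fin n) : Fin n → Fin n → Set where
    here : ∀ {x} → x ≢ u → ReachAvoid u x x
    step : ∀ {x y z} → ReachAvoid u x y → E y z → z ≢ u → ReachAvoid u x z

  record IsCFG (s t : Fin n) : Set where
    field
      s≢t       : s ≢ t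
      s-no-in   : ∀ u → ¬ E u s
      t-no-out  : ∀ u → ¬ E t u
      reach-s   : ∀ v → Star E s v
      reach-t   : ∀ v → Star E v t

  module _ (s t : Fin n) where

    A : Fin n → Fin n → Set
    A u v = ReachAvoid u s v

    B : Fin n → Fin n → Set
    B u v = ReachAvoid u v t

    ForwardInferable : Fin n → Set
    ForwardInferable u =
      (∃ λ v → E u v × ¬ A u v) × (∀ v → E u v → A u v → B u v → ⊥)

    BackwardInferable : Fin n → Set
    BackwardInferable u =
      (∃ λ v → E v u × ¬ B u v) × (∀ v → E v u → A u v → B u v → ⊥)

    FEdge : Graph n
    FEdge u v = ForwardInferable u × E u v × ¬ A u v

    DEdge : Graph n
    DEdge u v = BackwardInferable u × E v u × ¬ B u v

    HEdge : Graph n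
    HEdge u v = FEdge u v ⊎ DEdge u v

next : ∀ {m} → Fin (suc m) → Fin (suc m)
next {m} i = suc (toℕ i) mod suc m

-- A simple directed cycle with k = suc m nodes in a graph H:
-- pairwise distinct nodes c 0, …, c m with edges c i → c (i+1 mod k).
record SimpleCycle {n : ℕ} (H : Graph n) (m : ℕ) : Set where
  field
    node     : Fin (suc m) → Fin n
    distinct : ∀ i j → node i ≡ node j → i ≡ j
    edge     : ∀ i → H (node i) (node (next i))

{-# OPTIONS --safe #-}
module Submission where

-- Read v ∉ A(u) as "u dominates v" and v ∉ B(u) as "u postdominates v"; postdominance is
-- dominance from t in the reversed graph. Both relations are transitive and antisymmetric on
-- distinct nodes. Of an inference edge u → v only one fact matters: u dominates its successor v
-- (forward) or postdominates its predecessor v (backward).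
-- Say w controls v if w dominates or postdominates v. If w controls u ≠ w and u → v is an
-- inference edge, then w controls v, so on a simple cycle every node controls every other one.
-- A forward edge followed by a backward edge then contradicts antisymmetry, hence on a cycle
-- with at least three nodes all edges point the same way, and chaining dominance (or
-- postdominance) around the cycle makes two neighbouring nodes dominate each other.

open import Defs
open import Data.Nat using (ℕ; zero; suc; _≤_; _<_; _+_; _∸_; _%_; NonZero; z≤n; s≤s; z<s; s<s; _<?_)
open import Data.Nat.Properties
  using (≤-refl; <-irrefl; <⇒≤; ≮⇒≥; m≤n⇒m≤1+n; +-suc; m<n+m; +-monoˡ-<; ∸-monoˡ-<; m+n∸m≡n; module ≤-Reasoning)
open import Data.Nat.DivMod
  using (_mod_; %-distribˡ-+; m%n%n≡m%n; m<n⇒m%n≡m; m≤n⇒[n∸m]%m≡n%m; m%n≤m; m%n<n; %-remove-+ˡ)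
open import Data.Nat.Divisibility using (∣-refl)
open import Data.Fin using (Fin; toℕ; _≟_)
open import Data.Fin.Properties using (toℕ-fromℕ<; fromℕ<-cong)
open import Data.Product using (_×_; _,_; proj₂)
open import Data.Sum using (_⊎_; inj₁; inj₂; [_,_]′; swap) renaming (map to map⊎)
open import Data.Empty using (⊥; ⊥-elim)
open import Function using (_∘_; flip; id)
open import Relation.Nullary using (¬_; yes; no)
open import Relation.Binary.PropositionalEquality
  using (_≡_; _≢_; refl; sym; trans; cong; subst; ≢-sym; module ≡-Reasoning)
open import Relation.Binary.Construct.Closure.ReflexiveTransitive using (Star; ε; _◅_; reverse)

[m+n%o]%o≡[m+n]%o : ∀ m n o .{{_ : NonZero o}} → (m + n % o) % o ≡ (m + n) % o
[m+n%o]%o≡[m+n]%o m n o = begin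
  (m + n % o) % o           ≡⟨ %-distribˡ-+ m (n % o) o ⟩
  (m % o + n % o % o) % o   ≡⟨ cong (λ x → (m % o + x) % o) (m%n%n≡m%n n o) ⟩
  (m % o + n % o) % o       ≡⟨ %-distribˡ-+ m n o ⟨
  (m + n) % o               ∎
  where open ≡-Reasoning

[m+n]%o≢n%o : ∀ m n o .{{_ : NonZero o}} → 0 < m → m < o → (m + n) % o ≢ n % o
[m+n]%o≢n%o m n o 0<m m<o eq = <-irrefl refl r<r
  where
  open ≤-Reasoning
  r = n % o

  wrap : (m + r) % o ≡ r
  wrap = trans ([m+n%o]%o≡[m+n]%o m n o) eq

  r<r : r < r
  r<r with m + r <? o
  ... | yes m+r<o = begin-strict
    r               <⟨ m<n+m r 0<m ⟩
    m + r           ≡⟨ m<n⇒m%n≡m m+r<o ⟨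
    (m + r) % o     ≡⟨ wrap ⟩
    r               ∎
  ... | no m+r≮o = begin-strict
    r               ≡⟨ wrap ⟨
    (m + r) % o     ≡⟨ m≤n⇒[n∸m]%m≡n%m (≮⇒≥ m+r≮o) ⟨
    (m + r ∸ o) % o ≤⟨ m%n≤m (m + r ∸ o) o ⟩
    m + r ∸ o       <⟨ ∸-monoˡ-< (+-monoˡ-< r m<o) (≮⇒≥ m+r≮o) ⟩
    o + r ∸ o       ≡⟨ m+n∸m≡n o r ⟩
    r               ∎

private
  variable
    n : ℕ
    E : Graph n
    u v x y z : Fin n

avoid-target≢ : ReachAvoid E u x y → y ≢ u
avoid-target≢ (here y≢u)     = y≢u
avoid-target≢ (step _ _ y≢u) = y≢u

avoid-cons : E x y → x ≢ u → ReachAvoid E u y z → ReachAvoid E u x z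
avoid-cons e x≢u (here y≢u)       = step (here x≢u) e y≢u
avoid-cons e x≢u (step p e′ z≢u) = step (avoid-cons e x≢u p) e′ z≢u

avoid-reverse : ReachAvoid E u x y → ReachAvoid (flip E) u y x
avoid-reverse (here x≢u)     = here x≢u
avoid-reverse (step p e z≢u) = avoid-cons e z≢u (avoid-reverse p)

avoid-or-visit : ∀ v → ReachAvoid E u x y → ReachAvoid E v x y ⊎ ReachAvoid E u x v
avoid-or-visit v (here {x} x≢u) with x ≟ v
... | yes refl = inj₂ (here x≢u)
... | no x≢v   = inj₁ (here x≢v)
avoid-or-visit v (step {z = z} p e z≢u) with avoid-or-visit v p
... | inj₂ p′ = inj₂ p′
... | inj₁ p′ with z ≟ v
...   | yes refl = inj₂ (step p e z≢u)
...   | no z≢v   = inj₁ (step p′ e z≢v)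

module Dominance {n : ℕ} (E : Graph n) (r : Fin n) where

  _dominates_ : Fin n → Fin n → Set
  u dominates v = ¬ ReachAvoid E u r v

  dominates-trans : ∀ {u v w} → u dominates v → v dominates w → u dominates w
  dominates-trans {v = v} u-dom-v v-dom-w = [ v-dom-w , u-dom-v ]′ ∘ avoid-or-visit v

  dominates-predecessor : ∀ {u v w} → E v u → u ≢ w → w dominates u → w dominates v
  dominates-predecessor e u≢w w-dom-u p = w-dom-u (step p e u≢w)

  dominates-antisym : (∀ x → Star E r x) →
                      ∀ {u v} → u ≢ v → u dominates v → v dominates u → ⊥
  dominates-antisym reach {u} {v} u≢v u-dom-v v-dom-u = finish (walk (reach u) (enter r here here))
    where
    -- Whichever of u, v a walk from r meets first is reached by a path avoiding the other.
    Invariant : Fin n → Set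
    Invariant x = (ReachAvoid E u r x × ReachAvoid E v r x) ⊎ (ReachAvoid E v r u ⊎ ReachAvoid E u r v)

    enter : ∀ x → (x ≢ u → ReachAvoid E u r x) → (x ≢ v → ReachAvoid E v r x) → Invariant x
    enter x avoid-u avoid-v with x ≟ u | x ≟ v
    ... | yes refl | _        = inj₂ (inj₁ (avoid-v u≢v))
    ... | no x≢u   | yes refl = inj₂ (inj₂ (avoid-u x≢u))
    ... | no x≢u   | no x≢v   = inj₁ (avoid-u x≢u , avoid-v x≢v)

    walk : ∀ {x y} → Star E x y → Invariant x → Invariant y
    walk ε        inv            = inv
    walk (e ◅ es) (inj₁ (p , q)) = walk es (enter _ (step p e) (step q e))
    walk (_ ◅ _)  (inj₂ met)     = inj₂ met

    finish : Invariant u → ⊥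
    finish (inj₁ (p , _))  = avoid-target≢ p refl
    finish (inj₂ (inj₁ q)) = v-dom-u q
    finish (inj₂ (inj₂ p)) = u-dom-v p

SimpleCycle-map : ∀ {n m} {H H′ : Graph n} → (∀ {u v} → H u v → H′ u v) → SimpleCycle H m → SimpleCycle H′ m
SimpleCycle-map f cycle = record { node = node ; distinct = distinct ; edge = f ∘ edge }
  where open SimpleCycle cycle

module CycleWalk {n m : ℕ} {H : Graph n} (cycle : SimpleCycle H (suc m)) where
  open SimpleCycle cycle

  k : ℕ
  k = suc (suc m)

  c : ℕ → Fin n
  c j = node (j mod k)

  edge-at : ∀ j → H (c j) (c (suc j))
  edge-at j = subst (λ i → H (c j) (node i)) next-mod (edge (j mod k))
    where
    next-mod : next (j mod k) ≡ suc j mod k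
    next-mod = fromℕ<-cong _ _ (trans (cong (λ x → suc x % k) (toℕ-fromℕ< (m%n<n j k)))
                                      ([m+n%o]%o≡[m+n]%o 1 j k)) _ _

  c-periodic : ∀ j → c (k + j) ≡ c j
  c-periodic j = cong node (fromℕ<-cong _ _ (%-remove-+ˡ j (∣-refl {k})) _ _)

  c-distinct : ∀ i d → 0 < d → d < k → c (d + i) ≢ c i
  c-distinct i d 0<d d<k eq = [m+n]%o≢n%o d i k 0<d d<k
    (trans (sym (toℕ-fromℕ< (m%n<n (d + i) k)))
           (trans (cong toℕ (distinct _ _ eq)) (toℕ-fromℕ< (m%n<n i k))))

  module _ (R : Fin n → Fin n → Set)
           (base : ∀ j → R (c j) (c (suc j)))
           (extend : ∀ {w} j → c j ≢ w → R w (c j) → R w (c (suc j))) where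

    propagate : ∀ i {l} → l ≤ m → R (c i) (c (suc (l + i)))
    propagate i {zero}  _     = base i
    propagate i {suc l} 1+l≤m =
      extend (suc (l + i)) (c-distinct i (suc l) z<s (s<s (m≤n⇒m≤1+n 1+l≤m))) (propagate i (<⇒≤ 1+l≤m))

    around : ∀ i → R (c (suc i)) (c i)
    around i = subst (R (c (suc i))) (trans (cong (c ∘ suc) (+-suc m i)) (c-periodic i))
                     (propagate (suc i) ≤-refl)

module Inference {n : ℕ} (E : Graph n) (r r′ : Fin n) where
  open Dominance E r using (_dominates_; dominates-trans; dominates-predecessor; dominates-antisym)
  open Dominance (flip E) r′
    renaming ( _dominates_ to _postdominates_; dominates-trans to postdominates-trans
             ; dominates-predecessor to postdominates-successor; dominates-antisym to postdominates-antisym)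

  Forward : Graph n
  Forward u v = E u v × u dominates v

  Backward : Graph n
  Backward u v = E v u × u postdominates v

  InferenceEdge : Graph n
  InferenceEdge u v = Forward u v ⊎ Backward u v

  Controls : Fin n → Fin n → Set
  Controls w v = w dominates v ⊎ w postdominates v

  controls-edge : InferenceEdge u v → Controls u v
  controls-edge = map⊎ proj₂ proj₂

  controls-step : ∀ {w} → InferenceEdge u v → u ≢ w → Controls w u → Controls w v
  controls-step (inj₁ (_ , u-dom-v))  _   (inj₁ w-dom-u)  = inj₁ (dominates-trans w-dom-u u-dom-v)
  controls-step (inj₁ (e , _))        u≢w (inj₂ w-pdom-u) = inj₂ (postdominates-successor e u≢w w-pdom-u)
  controls-step (inj₂ (e , _))        u≢w (inj₁ w-dom-u)  = inj₁ (dominates-predecessor e u≢w w-dom-u)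
  controls-step (inj₂ (_ , u-pdom-v)) _   (inj₂ w-pdom-u) = inj₂ (postdominates-trans w-pdom-u u-pdom-v)

  module _ (from-r : ∀ v → Star E r v) (to-r′ : ∀ v → Star (flip E) r′ v) where

    forward-then-backward : ∀ {p m q} → m ≢ p → q ≢ m → q ≢ p → Forward p m → Backward m q →
                            Controls q m → Controls p q → Controls m p → ⊥
    forward-then-backward _ q≢m _ _ (_ , m-pdom-q) (inj₂ q-pdom-m) _ _ =
      postdominates-antisym to-r′ (≢-sym q≢m) m-pdom-q q-pdom-m
    forward-then-backward _ q≢m q≢p (Epm , _) _ (inj₁ q-dom-m) (inj₁ p-dom-q) _ =
      dominates-antisym from-r (≢-sym q≢p) p-dom-q (dominates-predecessor Epm (≢-sym q≢m) q-dom-m)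
    forward-then-backward m≢p _ _ (_ , p-dom-m) _ (inj₁ _) (inj₂ _) (inj₁ m-dom-p) =
      dominates-antisym from-r (≢-sym m≢p) p-dom-m m-dom-p
    forward-then-backward m≢p _ q≢p _ (Eqm , _) (inj₁ _) (inj₂ p-pdom-q) (inj₂ m-pdom-p) =
      postdominates-antisym to-r′ (≢-sym m≢p) (postdominates-successor Eqm q≢p p-pdom-q) m-pdom-p

    module _ {m : ℕ} (cycle : SimpleCycle InferenceEdge (suc (suc m))) where
      open CycleWalk cycle

      controls-backward : ∀ i → Controls (c (suc i)) (c i)
      controls-backward = around Controls (controls-edge ∘ edge-at) (controls-step ∘ edge-at)

      controls-two-ahead : ∀ i → Controls (c i) (c (suc (suc i)))
      controls-two-ahead i =
        propagate Controls (controls-edge ∘ edge-at) (controls-step ∘ edge-at) i (s≤s z≤n)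

      all-forward : Forward (c 0) (c 1) → ∀ j → Forward (c j) (c (suc j))
      all-forward f₀ zero = f₀
      all-forward f₀ (suc j) with edge-at (suc j)
      ... | inj₁ f = f
      ... | inj₂ b = ⊥-elim (forward-then-backward
                              (c-distinct j 1 z<s (s<s z<s)) (c-distinct (suc j) 1 z<s (s<s z<s))
                              (c-distinct j 2 z<s (s<s (s<s z<s)))
                              (all-forward f₀ j) b
                              (controls-backward (suc j)) (controls-two-ahead j) (controls-backward j))

      no-forward-start : Forward (c 0) (c 1) → ⊥
      no-forward-start f₀ = dominates-antisym from-r (c-distinct 0 1 z<s (s<s z<s)) c₁-dom-c₀ (proj₂ f₀)
        where
        c₁-dom-c₀ : c 1 dominates c 0
        c₁-dom-c₀ = around _dominates_ (proj₂ ∘ all-forward f₀)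
                      (λ j _ w-dom-cj → dominates-trans w-dom-cj (proj₂ (all-forward f₀ j))) 0

no-long-inference-cycle : ∀ (E : Graph n) r r′ →
                          (∀ v → Star E r v) → (∀ v → Star (flip E) r′ v) → ∀ {m} →
                          SimpleCycle (Inference.InferenceEdge E r r′) (suc (suc m)) → ⊥
-- A backward edge is a forward edge of the reversed graph with entry and exit exchanged.
no-long-inference-cycle E r r′ from-r to-r′ cycle =
  [ Inference.no-forward-start E r r′ from-r to-r′ cycle
  , Inference.no-forward-start (flip E) r′ r to-r′ from-r (SimpleCycle-map swap cycle)
  ]′ (SimpleCycle.edge cycle Fin.zero)

HEdge⇒InferenceEdge : ∀ (E : Graph n) s t → HEdge E s t u v → Inference.InferenceEdge E s t u v
HEdge⇒InferenceEdge E s t (inj₁ (_ , e , u-dom-v))  = inj₁ (e , u-dom-v)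
HEdge⇒InferenceEdge E s t (inj₂ (_ , e , u-pdom-v)) = inj₂ (e , u-pdom-v ∘ avoid-reverse)

lemma6 : (n : ℕ) (E : Graph n) (s t : Fin n) → IsCFG E s t →
         (m : ℕ) → SimpleCycle (HEdge E s t) m → suc m ≤ 2
lemma6 n E s t cfg zero          _     = s≤s z≤n
lemma6 n E s t cfg (suc zero)    _     = s≤s (s≤s z≤n)
lemma6 n E s t cfg (suc (suc m)) cycle =
  ⊥-elim (no-long-inference-cycle E s t reach-s (reverse id ∘ reach-t)
                                  (SimpleCycle-map (HEdge⇒InferenceEdge E s t) cycle))
  where open IsCFG cfg
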